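{- Let $G_1$ be a reduced graph (as defined in the context). Then there is a maximum path-cycle cover of $G_1$ in which every path component of length at most $3$ has an endpoint that is adjacent, via an edge of $G_1$, to a vertex not in that path component.
   Context: Throughout, $G_1$ is a connected undirected simple graph which is not a tree and which is reduced, meaning: (R1) every edge of $G_1$ whose two ends are each adjacent to a leaf (degree-$1$ vertex) of $G_1$ is a cut edge of $G_1$; (R2) no cut vertex of $G_1$ adjacent to a leaf of $G_1$ is super (a cut vertex is super if deleting it increases the number of connected components by at least $2$). Moreover it is assumed that no maximum path-cycle cover of $G_1$ consists of a single connected component. A path-cycle cover of $G_1$ is a spanning subgraph in which every vertex has degree at most $2$; it is maximum if it has the maximum number of edges among all path-cycle covers. Its connected components are path components and cycle components; the length of a path is its number of edges; a path of length $0$ is a singleton. A vertex of a path component is inner if its degree in the path is $2$ and an endpoint otherwise (the endpoint of a singleton is the singleton vertex itself). -}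

module Defs where

open import Data.Nat using (ℕ; zero; suc; _+_; _≤_; _<_; _≡ᵇ_; _<ᵇ_)
open import Data.Bool using (Bool; true; false; if_then_else_; _∧_; _∨_; not)
open import Data.Fin using (Fin; zero; suc; toℕ; fromℕ)
open import Data.Product using (Σ; ∃; _×_; _,_)
open import Data.Sum using (_⊎_)
open import Relation.Nullary using (¬_)
open import Relation.Binary.PropositionalEquality using (_≡_)

record Graph (n : ℕ) : Set where
  field
    adj    : Fin n → Fin n → Bool
    sym    : ∀ u v → adj u v ≡ adj v u
    irrefl : ∀ u → adj u u ≡ false
open Graph public

_==_ : ∀ {n} → Fin n → Fin n → Bool
u == v = toℕ u ≡ᵇ toℕ v

countTrue : ∀ {m} → (Fin m → Bool) → ℕ
countTrue {zero}  f = 0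
countTrue {suc m} f = (if f zero then 1 else 0) + countTrue (λ i → f (suc i))

sumFin : ∀ {m} → (Fin m → ℕ) → ℕ
sumFin {zero}  f = 0
sumFin {suc m} f = f zero + sumFin (λ i → f (suc i))

deg : ∀ {n} → (Fin n → Fin n → Bool) → Fin n → ℕ
deg E u = countTrue (E u)

numEdges : ∀ {n} → (Fin n → Fin n → Bool) → ℕ
numEdges E = sumFin (λ u → countTrue (λ v → (toℕ u <ᵇ toℕ v) ∧ E u v))

-- Reachability inside the subgraph with vertex set {w | keep w} and edges E
data Reach {n} (keep : Fin n → Bool) (E : Fin n → Fin n → Bool) : Fin n → Fin n → Set where
  here : ∀ {u} → keep u ≡ true → Reach keep E u u
  step : ∀ {u v w} → Reach keep E u v → E v w ≡ true → keep w ≡ true → Reach keep E u w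

allV : ∀ {n} → Fin n → Bool
allV _ = true

-- The graph (keep, E) has exactly c connected components:
-- a system of c pairwise non-connected representatives covering every vertex.
NumComps : ∀ {n} → (Fin n → Bool) → (Fin n → Fin n → Bool) → ℕ → Set
NumComps {n} keep E c =
  Σ (Fin c → Fin n) λ f →
    (∀ i → keep (f i) ≡ true) ×
    (∀ i j → Reach keep E (f i) (f j) → i ≡ j) ×
    (∀ u → keep u ≡ true → ∃ λ i → Reach keep E u (f i))

Connected : ∀ {n} → Graph n → Set
Connected G = ∀ u v → Reach allV (adj G) u v

HasCycle : ∀ {n} → Graph n → Set
HasCycle {n} G = Σ ℕ λ k → Σ (Fin (suc (suc (suc k))) → Fin n) λ c →
  (∀ i j → c i ≡ c j → i ≡ j) ×
  (∀ i j → suc (toℕ i) ≡ toℕ j → adj G (c i) (c j) ≡ true) ×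
  (adj G (c (fromℕ (suc (suc k)))) (c zero) ≡ true)

IsTree : ∀ {n} → Graph n → Set
IsTree G = Connected G × ¬ HasCycle G

IsLeaf : ∀ {n} → Graph n → Fin n → Set
IsLeaf G u = deg (adj G) u ≡ 1

AdjToLeaf : ∀ {n} → Graph n → Fin n → Set
AdjToLeaf G u = ∃ λ l → IsLeaf G l × adj G u l ≡ true

delEdge : ∀ {n} → Graph n → Fin n → Fin n → Fin n → Fin n → Bool
delEdge G a b u v = adj G u v ∧ not (((u == a) ∧ (v == b)) ∨ ((u == b) ∧ (v == a)))

delVert : ∀ {n} → Fin n → Fin n → Bool
delVert v w = not (w == v)

IsCutEdge : ∀ {n} → Graph n → Fin n → Fin n → Set
IsCutEdge G a b = ∃ λ c → ∃ λ c' →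
  NumComps allV (adj G) c × NumComps allV (delEdge G a b) c' × c < c'

IsCutVertex : ∀ {n} → Graph n → Fin n → Set
IsCutVertex G v = ∃ λ c → ∃ λ c' →
  NumComps allV (adj G) c × NumComps (delVert v) (adj G) c' × c < c'

IsSuperCutVertex : ∀ {n} → Graph n → Fin n → Set
IsSuperCutVertex G v = ∃ λ c → ∃ λ c' →
  NumComps allV (adj G) c × NumComps (delVert v) (adj G) c' × suc (suc c) ≤ c'

Reduced : ∀ {n} → Graph n → Set
Reduced G =
  (∀ a b → adj G a b ≡ true → AdjToLeaf G a → AdjToLeaf G b → IsCutEdge G a b) ×
  (∀ v → IsCutVertex G v → AdjToLeaf G v → ¬ IsSuperCutVertex G v)

-- path-cycle cover: symmetric spanning subgraph with max degree 2
IsPCC : ∀ {n} → Graph n → (Fin n → Fin n → Bool) → Set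
IsPCC G H =
  (∀ u v → H u v ≡ H v u) ×
  (∀ u v → H u v ≡ true → adj G u v ≡ true) ×
  (∀ u → deg H u ≤ 2)

IsMaxPCC : ∀ {n} → Graph n → (Fin n → Fin n → Bool) → Set
IsMaxPCC G H = IsPCC G H × (∀ H' → IsPCC G H' → numEdges H' ≤ numEdges H)

-- p : Fin (suc k) → Fin n is (the vertex sequence of) a path component of H of length k:
-- distinct vertices, H-edges among them exactly between consecutive ones,
-- and no H-edge leaving the set.
IsPathComponent : ∀ {n} → (Fin n → Fin n → Bool) → (k : ℕ) → (Fin (suc k) → Fin n) → Set
IsPathComponent {n} H k p =
  (∀ i j → p i ≡ p j → i ≡ j) ×
  (∀ i j → H (p i) (p j) ≡ true → (suc (toℕ i) ≡ toℕ j ⊎ suc (toℕ j) ≡ toℕ i)) ×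
  (∀ i j → suc (toℕ i) ≡ toℕ j → H (p i) (p j) ≡ true) ×
  (∀ i w → H (p i) w ≡ true → ∃ λ j → p j ≡ w)

HasOutsideNbr : ∀ {n k} → Graph n → (Fin (suc k) → Fin n) → Fin n → Set
HasOutsideNbr G p e = ∃ λ w → adj G e w ≡ true × (∀ j → ¬ p j ≡ w)

-- Fix a path-cycle cover H with the most edges and, among those, the most vertices of
-- degree 2, and let P be a path component of length at most 3 whose endpoints have no
-- neighbours outside P. An edge joining the two endpoints could be added to H, and for
-- P = a–b–c–d an edge ac could replace cd, closing the cycle a–b–c; hence the endpoints of P
-- are leaves of G. If the second vertex b has a neighbour x outside P, then a, x and the third
-- vertex c lie in three different components of G − b (for length 3 because bc joins two
-- vertices adjacent to leaves and so is a cut edge by (R1)): b is a super cut vertex next to a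
-- leaf, against (R2). The third vertex is the second one of the reversed path. So no vertex of P
-- has a neighbour outside P; then P spans the connected graph G and H is a single component,
-- which is excluded.

module Submission where

open import Defs hiding (sym)
open import Data.Bool using (Bool; true; false; if_then_else_; _∧_; _∨_; not)
open import Data.Bool.Properties
  using (T-≡; ∧-zeroʳ; ∧-conicalˡ; ∧-conicalʳ; ∨-comm; ∧-comm; ∨-zeroʳ; ¬-not; not-¬)
  renaming (_≟_ to _≟ᴮ_)
open import Data.Empty using (⊥; ⊥-elim)
open import Data.Fin using (Fin; zero; suc; toℕ; fromℕ; inject₁; opposite; #_; _≟_)
open import Data.Fin.Properties
  using (toℕ-injective; toℕ<n; toℕ-inject₁; opposite-prop; opposite-involutive; any?; all?; injective⇒≤)
import Data.Fin.Properties as Finₚ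
open import Data.List using (List; []; _∷_; cartesianProductWith; filter)
open import Data.List.Extrema.Nat using (argmax; argmax-all; f[xs]≤f[argmax])
open import Data.List.Membership.Propositional using (_∈_)
open import Data.List.Membership.Propositional.Properties using (∈-cartesianProductWith⁺; ∈-filter⁺)
open import Data.List.Relation.Unary.All using (lookup)
open import Data.List.Relation.Unary.All.Properties using (all-filter)
open import Data.List.Relation.Unary.Any using (here; there)
open import Data.Nat using (ℕ; zero; suc; _+_; _*_; _∸_; _≤_; _<_; z≤n; s≤s; _<ᵇ_; _≤ᵇ_; _≤?_)
open import Data.Nat.Properties hiding (_≟_)
open import Data.Product using (Σ; ∃; _×_; _,_; proj₁; proj₂)
open import Data.Sum using (_⊎_; inj₁; inj₂; [_,_]; swap)
import Data.Sum as Sum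
open import Data.Vec.Functional using () renaming (_∷_ to _◂_)
open import Function using (_∘_; case_of_)
open import Function.Bundles using (module Equivalence)
open import Relation.Binary using (tri<; tri≈; tri>)
open import Relation.Binary.PropositionalEquality
  using (_≡_; refl; sym; trans; cong; cong₂; subst; subst₂; module ≡-Reasoning)
open import Relation.Nullary using (¬_; Dec; yes; no)
open import Relation.Nullary.Decidable using (_×-dec_; _→-dec_; ¬?)

==-refl : ∀ {n} (u : Fin n) → (u == u) ≡ true
==-refl zero    = refl
==-refl (suc u) = ==-refl u

==⇒≡ : ∀ {n} {u v : Fin n} → (u == v) ≡ true → u ≡ v
==⇒≡ {u = zero}  {zero}  _ = refl
==⇒≡ {u = suc u} {suc v} e = cong suc (==⇒≡ e)

≢⇒==-false : ∀ {n} {u v : Fin n} → ¬ u ≡ v → (u == v) ≡ false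
≢⇒==-false u≢v = ¬-not (u≢v ∘ ==⇒≡)

∨-introˡ : ∀ {a} b → a ≡ true → (a ∨ b) ≡ true
∨-introˡ b refl = refl

∨-introʳ : ∀ a {b} → b ≡ true → (a ∨ b) ≡ true
∨-introʳ a refl = ∨-zeroʳ a

∨-elim : ∀ a {b} → (a ∨ b) ≡ true → a ≡ true ⊎ b ≡ true
∨-elim true  _ = inj₁ refl
∨-elim false e = inj₂ e

∧-intro : ∀ {a b} → a ≡ true → b ≡ true → (a ∧ b) ≡ true
∧-intro refl refl = refl

-- Counting

_⊆ᵇ_ : ∀ {A : Set} → (A → Bool) → (A → Bool) → Set
f ⊆ᵇ g = ∀ i → f i ≡ true → g i ≡ true

private
  ind : Bool → ℕ
  ind b = if b then 1 else 0

  ind-mono : ∀ {a b} → (a ≡ true → b ≡ true) → ind a ≤ ind b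
  ind-mono {false} _   = z≤n
  ind-mono {true}  a⇒b rewrite a⇒b refl = ≤-refl

countTrue-cong : ∀ {m} {f g : Fin m → Bool} → (∀ i → f i ≡ g i) → countTrue f ≡ countTrue g
countTrue-cong {zero}  _  = refl
countTrue-cong {suc m} eq = cong₂ _+_ (cong ind (eq zero)) (countTrue-cong (eq ∘ suc))

countTrue-mono : ∀ {m} {f g : Fin m → Bool} → f ⊆ᵇ g → countTrue f ≤ countTrue g
countTrue-mono {zero}  _   = z≤n
countTrue-mono {suc m} f⊆g = +-mono-≤ (ind-mono (f⊆g zero)) (countTrue-mono (f⊆g ∘ suc))

countTrue-< : ∀ {m} {f g : Fin m → Bool} → f ⊆ᵇ g → ∀ x → f x ≡ false → g x ≡ true →
              countTrue f < countTrue g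
countTrue-< f⊆g zero    fx gx rewrite fx | gx = s≤s (countTrue-mono (f⊆g ∘ suc))
countTrue-< f⊆g (suc x) fx gx = +-mono-≤-< (ind-mono (f⊆g zero)) (countTrue-< (f⊆g ∘ suc) x fx gx)

countTrue≤size : ∀ {m} (f : Fin m → Bool) → countTrue f ≤ m
countTrue≤size {zero}  f = z≤n
countTrue≤size {suc m} f with f zero
... | true  = s≤s (countTrue≤size (f ∘ suc))
... | false = m≤n⇒m≤1+n (countTrue≤size (f ∘ suc))

countTrue-false : ∀ {m} {f : Fin m → Bool} → (∀ i → f i ≡ false) → countTrue f ≡ 0
countTrue-false {zero}  _  = refl
countTrue-false {suc m} f0 rewrite f0 zero = countTrue-false (f0 ∘ suc)

countTrue-pos : ∀ {m} {f : Fin m → Bool} x → f x ≡ true → 0 < countTrue f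
countTrue-pos zero    fx rewrite fx = s≤s z≤n
countTrue-pos (suc x) fx = ≤-trans (countTrue-pos x fx) (m≤n+m _ _)

countTrue-∨ : ∀ {m} (f g : Fin m → Bool) → countTrue (λ i → f i ∨ g i) ≤ countTrue f + countTrue g
countTrue-∨ {zero}  f g = z≤n
countTrue-∨ {suc m} f g with f zero | g zero | countTrue-∨ (f ∘ suc) (g ∘ suc)
... | false | false | ih = ih
... | false | true  | ih =
  subst (suc (countTrue (λ i → f (suc i) ∨ g (suc i))) ≤_) (sym (+-suc (countTrue (f ∘ suc)) _)) (s≤s ih)
... | true  | b     | ih = s≤s (≤-trans ih (+-monoʳ-≤ (countTrue (f ∘ suc)) (m≤n+m _ (ind b))))

countTrue-∪ : ∀ {m} {f g h : Fin m → Bool} → (∀ i → f i ≡ true → g i ≡ true ⊎ h i ≡ true) →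
              countTrue f ≤ countTrue g + countTrue h
countTrue-∪ {g = g} {h} f⊆g∪h = ≤-trans (countTrue-mono into) (countTrue-∨ g h)
  where
  into : ∀ i → _ → (g i ∨ h i) ≡ true
  into i fi with f⊆g∪h i fi
  ... | inj₁ gi = ∨-introˡ (h i) gi
  ... | inj₂ hi = ∨-introʳ (g i) hi

countTrue-== : ∀ {m} (x : Fin m) → countTrue (_== x) ≡ 1
countTrue-== {suc m} zero    = cong suc (countTrue-false {m} λ _ → refl)
countTrue-== {suc m} (suc x) = countTrue-== x

countTrue≤1 : ∀ {m} {f : Fin m → Bool} x → (∀ i → f i ≡ true → i ≡ x) → countTrue f ≤ 1
countTrue≤1 x only-x = subst (_ ≤_) (countTrue-== x)
  (countTrue-mono λ i fi → subst (λ y → (i == y) ≡ true) (only-x i fi) (==-refl i))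

countTrue≤2 : ∀ {m} {f : Fin m → Bool} x y → (∀ i → f i ≡ true → i ≡ x ⊎ i ≡ y) → countTrue f ≤ 2
countTrue≤2 {f = f} x y only-xy =
  ≤-trans (countTrue-∪ into) (≤-reflexive (cong₂ _+_ (countTrue-== x) (countTrue-== y)))
  where
  into : ∀ i → f i ≡ true → (i == x) ≡ true ⊎ (i == y) ≡ true
  into i fi with only-xy i fi
  ... | inj₁ refl = inj₁ (==-refl i)
  ... | inj₂ refl = inj₂ (==-refl i)

countTrue≥2 : ∀ {m} {f : Fin m → Bool} {x y} → ¬ x ≡ y → f x ≡ true → f y ≡ true → 2 ≤ countTrue f
countTrue≥2 {f = f} {x} {y} x≢y fx fy = subst (_< countTrue f) (countTrue-== x)
  (countTrue-< (λ i i=x → subst (λ z → f z ≡ true) (sym (==⇒≡ i=x)) fx) y (≢⇒==-false (x≢y ∘ sym)) fy)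

countTrue≡1 : ∀ {m} {f : Fin m → Bool} x → f x ≡ true → (∀ i → f i ≡ true → i ≡ x) →
              countTrue f ≡ 1
countTrue≡1 x fx only-x = ≤-antisym (countTrue≤1 x only-x) (countTrue-pos x fx)

sumFin-cong : ∀ {m} {F G : Fin m → ℕ} → (∀ i → F i ≡ G i) → sumFin F ≡ sumFin G
sumFin-cong {zero}  _  = refl
sumFin-cong {suc m} eq = cong₂ _+_ (eq zero) (sumFin-cong (eq ∘ suc))

sumFin-mono : ∀ {m} {F G : Fin m → ℕ} → (∀ i → F i ≤ G i) → sumFin F ≤ sumFin G
sumFin-mono {zero}  _   = z≤n
sumFin-mono {suc m} F≤G = +-mono-≤ (F≤G zero) (sumFin-mono (F≤G ∘ suc))

sumFin-< : ∀ {m} {F G : Fin m → ℕ} → (∀ i → F i ≤ G i) → ∀ x → F x < G x → sumFin F < sumFin G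
sumFin-< F≤G zero    lt = +-mono-<-≤ lt (sumFin-mono (F≤G ∘ suc))
sumFin-< F≤G (suc x) lt = +-mono-≤-< (F≤G zero) (sumFin-< (F≤G ∘ suc) x lt)

sumFin≤suc : ∀ {m} {F G : Fin m → ℕ} x → (∀ i → ¬ i ≡ x → F i ≤ G i) → F x ≤ suc (G x) →
             sumFin F ≤ suc (sumFin G)
sumFin≤suc zero    F≤G Fx≤ = +-mono-≤ Fx≤ (sumFin-mono λ i → F≤G (suc i) λ ())
sumFin≤suc {F = F} {G} (suc x) F≤G Fx≤ = subst (sumFin F ≤_) (+-suc (G zero) _)
  (+-mono-≤ (F≤G zero λ ()) (sumFin≤suc x (λ i i≢x → F≤G (suc i) (i≢x ∘ Finₚ.suc-injective)) Fx≤))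

-- Edge relations

Edges : ℕ → Set
Edges n = Fin n → Fin n → Bool

SymmetricEdges : ∀ {n} → Edges n → Set
SymmetricEdges H = ∀ u v → H u v ≡ H v u

_⊆ᴱ_ : ∀ {n} → Edges n → Edges n → Set
H ⊆ᴱ H' = ∀ u v → H u v ≡ true → H' u v ≡ true

edge : ∀ {n} → Fin n → Fin n → Edges n
edge x y u v = ((u == x) ∧ (v == y)) ∨ ((u == y) ∧ (v == x))

insertEdge : ∀ {n} → Edges n → Fin n → Fin n → Edges n
insertEdge H x y u v = H u v ∨ edge x y u v

removeEdge : ∀ {n} → Edges n → Fin n → Fin n → Edges n
removeEdge H x y u v = H u v ∧ not (edge x y u v)

module _ {n} {x y : Fin n} where

  edge-xy : edge x y x y ≡ true
  edge-xy = ∨-introˡ _ (∧-intro (==-refl x) (==-refl y))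

  edge-yx : edge x y y x ≡ true
  edge-yx = ∨-introʳ _ (∧-intro (==-refl y) (==-refl x))

  edge-sym : ∀ u v → edge x y u v ≡ edge x y v u
  edge-sym u v = trans (∨-comm ((u == x) ∧ (v == y)) ((u == y) ∧ (v == x)))
                       (cong₂ _∨_ (∧-comm (u == y) (v == x)) (∧-comm (u == x) (v == y)))

  edge⁻ : ∀ u v → edge x y u v ≡ true → (u ≡ x × v ≡ y) ⊎ (u ≡ y × v ≡ x)
  edge⁻ u v e with ∨-elim ((u == x) ∧ (v == y)) e
  ... | inj₁ e₁ = inj₁ (==⇒≡ (∧-conicalˡ _ _ e₁) , ==⇒≡ (∧-conicalʳ _ _ e₁))
  ... | inj₂ e₂ = inj₂ (==⇒≡ (∧-conicalˡ _ _ e₂) , ==⇒≡ (∧-conicalʳ _ _ e₂))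

  edge-false : ∀ {u v} → ¬ (u ≡ x × v ≡ y) → ¬ (u ≡ y × v ≡ x) → edge x y u v ≡ false
  edge-false {u} {v} ¬xy ¬yx = ¬-not λ e → [ ¬xy , ¬yx ] (edge⁻ u v e)

  edge-row≤1 : ∀ u → countTrue (edge x y u) ≤ 1
  edge-row≤1 u with u ≟ x
  ... | yes refl = countTrue≤1 {f = edge x y x} y only-y
    where
    only-y : ∀ v → edge x y x v ≡ true → v ≡ y
    only-y v e with edge⁻ x v e
    ... | inj₁ (_ , v≡y)       = v≡y
    ... | inj₂ (refl , refl) = refl
  ... | no u≢x = countTrue≤1 {f = edge x y u} x only-x
    where
    only-x : ∀ v → edge x y u v ≡ true → v ≡ x
    only-x v e with edge⁻ u v e
    ... | inj₁ (u≡x , _) = ⊥-elim (u≢x u≡x)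
    ... | inj₂ (_ , v≡x) = v≡x

  edge-row-off : ∀ {u} → ¬ u ≡ x → ¬ u ≡ y → countTrue (edge x y u) ≡ 0
  edge-row-off {u} u≢x u≢y =
    countTrue-false {f = edge x y u} λ v → edge-false {v = v} (u≢x ∘ proj₁) (u≢y ∘ proj₁)

insertEdge-sym : ∀ {n} {H : Edges n} {x y} → SymmetricEdges H → SymmetricEdges (insertEdge H x y)
insertEdge-sym H-sym u v = cong₂ _∨_ (H-sym u v) (edge-sym u v)

removeEdge-sym : ∀ {n} {H : Edges n} {x y} → SymmetricEdges H → SymmetricEdges (removeEdge H x y)
removeEdge-sym H-sym u v = cong₂ (λ a b → a ∧ not b) (H-sym u v) (edge-sym u v)

removeEdge-intro : ∀ {n} {H : Edges n} {x y u v} → H u v ≡ true →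
                   ¬ (u ≡ x × v ≡ y) → ¬ (u ≡ y × v ≡ x) → removeEdge H x y u v ≡ true
removeEdge-intro Huv ¬xy ¬yx = ∧-intro Huv (cong not (edge-false ¬xy ¬yx))

deg-insertEdge : ∀ {n} (H : Edges n) x y u → deg (insertEdge H x y) u ≤ deg H u + countTrue (edge x y u)
deg-insertEdge H x y u = countTrue-∨ (H u) (edge x y u)

private
  upper : ∀ {n} → Edges n → Fin n → Fin n → Bool
  upper H u v = (toℕ u <ᵇ toℕ v) ∧ H u v

  upper⁻ : ∀ {n} {H : Edges n} u v → upper H u v ≡ true → toℕ u < toℕ v × H u v ≡ true
  upper⁻ {H = H} u v e = <ᵇ⇒< _ _ (Equivalence.from T-≡ (∧-conicalˡ (toℕ u <ᵇ toℕ v) (H u v) e))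
                         , ∧-conicalʳ (toℕ u <ᵇ toℕ v) (H u v) e

  upper⁺ : ∀ {n} {H : Edges n} {u v} → toℕ u < toℕ v → H u v ≡ true → upper H u v ≡ true
  upper⁺ u<v Huv = ∧-intro (Equivalence.to T-≡ (<⇒<ᵇ u<v)) Huv

  upper-mono : ∀ {n} {H H' : Edges n} → H ⊆ᴱ H' → ∀ u → upper H u ⊆ᵇ upper H' u
  upper-mono {H = H} {H'} H⊆H' u v e = let u<v , Huv = upper⁻ {H = H} u v e in upper⁺ {H = H'} u<v (H⊆H' u v Huv)

numEdges-cong : ∀ {n} {H H' : Edges n} → (∀ u v → H u v ≡ H' u v) → numEdges H ≡ numEdges H'
numEdges-cong H≈H' = sumFin-cong λ u → countTrue-cong λ v → cong (_ ∧_) (H≈H' u v)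

private
  numEdges-<-oriented : ∀ {n} {H H' : Edges n} → H ⊆ᴱ H' → ∀ {x y} → toℕ x < toℕ y →
                        H x y ≡ false → H' x y ≡ true → numEdges H < numEdges H'
  numEdges-<-oriented {H = H} {H'} H⊆H' {x} {y} x<y Hxy H'xy =
    sumFin-< (λ u → countTrue-mono (upper-mono H⊆H' u)) x
      (countTrue-< (upper-mono H⊆H' x) y (trans (cong (_ ∧_) Hxy) (∧-zeroʳ (toℕ x <ᵇ toℕ y)))
                   (upper⁺ {H = H'} x<y H'xy))

numEdges-< : ∀ {n} {H H' : Edges n} → SymmetricEdges H → SymmetricEdges H' → H ⊆ᴱ H' →
             ∀ {x y} → ¬ x ≡ y → H x y ≡ false → H' x y ≡ true → numEdges H < numEdges H'
numEdges-< H-sym H'-sym H⊆H' {x} {y} x≢y Hxy H'xy with <-cmp (toℕ x) (toℕ y)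
... | tri< x<y _ _ = numEdges-<-oriented H⊆H' x<y Hxy H'xy
... | tri≈ _ x≡y _ = ⊥-elim (x≢y (toℕ-injective x≡y))
... | tri> _ _ y<x = numEdges-<-oriented H⊆H' y<x (trans (H-sym y x) Hxy) (trans (H'-sym y x) H'xy)

private
  numEdges-removeEdge-oriented : ∀ {n} (H : Edges n) {x y} → toℕ x < toℕ y →
                                 numEdges H ≤ suc (numEdges (removeEdge H x y))
  numEdges-removeEdge-oriented H {x} {y} x<y = sumFin≤suc x other-row row-x
    where
    x≢y : ¬ x ≡ y
    x≢y refl = <-irrefl refl x<y
    other-row : ∀ u → ¬ u ≡ x → countTrue (upper H u) ≤ countTrue (upper (removeEdge H x y) u)
    other-row u u≢x = countTrue-mono λ v e → let u<v , Huv = upper⁻ {H = H} u v e in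
      upper⁺ {H = removeEdge H x y} u<v
        (removeEdge-intro {H = H} {x} {y} Huv (u≢x ∘ proj₁) λ { (refl , refl) → <-asym x<y u<v })
    row-x : countTrue (upper H x) ≤ suc (countTrue (upper (removeEdge H x y) x))
    row-x = subst (countTrue (upper H x) ≤_)
      (trans (cong (countTrue (upper (removeEdge H x y) x) +_) (countTrue-== y)) (+-comm _ 1))
      (countTrue-∪ {f = upper H x} {g = upper (removeEdge H x y) x} {h = _== y}
                   λ v e → case-v v (upper⁻ {H = H} x v e))
      where
      case-v : ∀ v → toℕ x < toℕ v × H x v ≡ true →
               upper (removeEdge H x y) x v ≡ true ⊎ (v == y) ≡ true
      case-v v (x<v , Hxv) with v ≟ y
      ... | yes refl = inj₂ (==-refl v)
      ... | no v≢y   = inj₁ (upper⁺ {H = removeEdge H x y} x<v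
                                (removeEdge-intro {H = H} Hxv (v≢y ∘ proj₂) (x≢y ∘ proj₁)))

numEdges-removeEdge : ∀ {n} (H : Edges n) {x y} → ¬ x ≡ y → numEdges H ≤ suc (numEdges (removeEdge H x y))
numEdges-removeEdge H {x} {y} x≢y with <-cmp (toℕ x) (toℕ y)
... | tri< x<y _ _ = numEdges-removeEdge-oriented H x<y
... | tri≈ _ x≡y _ = ⊥-elim (x≢y (toℕ-injective x≡y))
... | tri> _ _ y<x = subst (λ m → numEdges H ≤ suc m)
      (numEdges-cong λ u v → cong (λ b → H u v ∧ not b) (∨-comm ((u == y) ∧ (v == x)) ((u == x) ∧ (v == y))))
      (numEdges-removeEdge-oriented H y<x)

-- Reachability and components

module _ {n} {keep : Fin n → Bool} {E : Edges n} where

  reach-source : ∀ {u w} → Reach keep E u w → keep u ≡ true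
  reach-source (here ku)     = ku
  reach-source (step r _ _) = reach-source r

  reach-target : ∀ {u w} → Reach keep E u w → keep w ≡ true
  reach-target (here kw)     = kw
  reach-target (step _ _ kw) = kw

  reach-trans : ∀ {u v w} → Reach keep E u v → Reach keep E v w → Reach keep E u w
  reach-trans r (here _)        = r
  reach-trans r (step r' e kw) = step (reach-trans r r') e kw

  reach-prepend : ∀ {u v w} → keep u ≡ true → E u v ≡ true → Reach keep E v w → Reach keep E u w
  reach-prepend ku e r = reach-trans (step (here ku) e (reach-source r)) r

  reach-sym : SymmetricEdges E → ∀ {u w} → Reach keep E u w → Reach keep E w u
  reach-sym E-sym (here k)                   = here k
  reach-sym E-sym (step {v = v} {w} r e kw) = reach-prepend kw (trans (E-sym w v) e) (reach-sym E-sym r)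

reach-map : ∀ {n} {keep keep' : Fin n → Bool} {E E' : Edges n} → keep ⊆ᵇ keep' →
            (∀ u v → keep u ≡ true → keep v ≡ true → E u v ≡ true → E' u v ≡ true) →
            ∀ {u w} → Reach keep E u w → Reach keep' E' u w
reach-map keep⊆ E⇒E' (here ku)                   = here (keep⊆ _ ku)
reach-map keep⊆ E⇒E' (step {v = v} {w} r e kw) =
  step (reach-map keep⊆ E⇒E' r) (E⇒E' v w (reach-target r) kw e) (keep⊆ w kw)

_∖_ : ∀ {n} → (Fin n → Bool) → Fin n → Fin n → Bool
(keep ∖ u) x = keep x ∧ not (x == u)

∖-⊆ : ∀ {n} (keep : Fin n → Bool) u → (keep ∖ u) ⊆ᵇ keep
∖-⊆ keep u x = ∧-conicalˡ (keep x) (not (x == u))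

∖-< : ∀ {n} {keep : Fin n → Bool} {u} → keep u ≡ true → countTrue (keep ∖ u) < countTrue keep
∖-< {keep = keep} {u} ku = countTrue-< (∖-⊆ keep u) u
  (subst (λ b → (keep u ∧ not b) ≡ false) (sym (==-refl u)) (∧-zeroʳ (keep u))) ku

module _ {n} {E : Edges n} where

  reach-uncons : ∀ {keep u w} → Reach keep E u w →
                 u ≡ w ⊎ ∃ λ v → E u v ≡ true × Reach (keep ∖ u) E v w
  reach-uncons (here _) = inj₁ refl
  reach-uncons {u = u} (step {w = w} r e kw) with w ≟ u
  ... | yes w≡u = inj₁ (sym w≡u)
  ... | no w≢u with reach-uncons r | ∧-intro kw (cong not (≢⇒==-false w≢u))
  ...   | inj₁ refl           | kw' = inj₂ (w , e , here kw')
  ...   | inj₂ (v , e' , r') | kw' = inj₂ (v , e' , step r' e kw')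

  private
    reach?-bounded : ∀ fuel keep → countTrue keep ≤ fuel → ∀ u w → Dec (Reach keep E u w)
    reach?-bounded fuel keep bound u w with keep u in ku | u ≟ w
    ... | false | _ = no λ r → not-¬ (reach-source r) ku
    ... | true | yes refl = yes (here ku)
    reach?-bounded zero keep bound u w | true | no _ =
      ⊥-elim (n≮0 (<-≤-trans (countTrue-pos u ku) bound))
    reach?-bounded (suc fuel) keep bound u w | true | no u≢w
      with any? (λ v → (E u v ≟ᴮ true) ×-dec
                       reach?-bounded fuel (keep ∖ u) (≤-pred (<-≤-trans (∖-< {keep = keep} {u} ku) bound)) v w)
    ... | yes (v , e , r) = yes (reach-prepend ku e (reach-map (∖-⊆ keep u) (λ _ _ _ _ e → e) r))
    ... | no ¬r = no λ r → [ u≢w , ¬r ] (reach-uncons r)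

  reach? : ∀ keep u w → Dec (Reach keep E u w)
  reach? keep = reach?-bounded (countTrue keep) keep ≤-refl

Transversal : ∀ {n} → (Fin n → Bool) → (Fin n → Fin n → Set) → ℕ → Set
Transversal {n} keep R c =
  Σ (Fin c → Fin n) λ f →
    (∀ i → keep (f i) ≡ true) ×
    (∀ i j → R (f i) (f j) → i ≡ j) ×
    (∀ u → keep u ≡ true → ∃ λ i → R u (f i))

module _ {n} {keep : Fin n → Bool} {R : Fin n → Fin n → Set}
         (R-sym : ∀ {u w} → R u w → R w u) (R-trans : ∀ {u v w} → R u v → R v w → R u w) where

  transversal-≥ : ∀ {c m} → Transversal keep R c → (xs : Fin m → Fin n) →
                  (∀ i → keep (xs i) ≡ true) → (∀ i j → R (xs i) (xs j) → i ≡ j) → m ≤ c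
  transversal-≥ (f , _ , _ , covers) xs kept separated = injective⇒≤ class-injective
    where
    class : ∀ i → ∃ λ k → R (xs i) (f k)
    class i = covers (xs i) (kept i)
    class-injective : ∀ {i j} → proj₁ (class i) ≡ proj₁ (class j) → i ≡ j
    class-injective {i} {j} same = separated i j
      (R-trans (proj₂ (class i)) (R-sym (subst (λ k → R (xs j) (f k)) (sym same) (proj₂ (class j)))))

transversal-exists : ∀ {n} (keep : Fin n → Bool) (R : Fin n → Fin n → Set) →
                     (∀ u w → Dec (R u w)) → (∀ {u} → keep u ≡ true → R u u) →
                     (∀ {u w} → R u w → R w u) → (∀ {u v w} → R u v → R v w → R u w) →
                     ∃ (Transversal keep R)
transversal-exists {zero} keep R _ _ _ _ = 0 , (λ ()) , (λ ()) , (λ ()) , λ ()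
transversal-exists {suc n} keep R R? R-refl R-sym R-trans
  with transversal-exists (keep ∘ suc) (λ u w → R (suc u) (suc w)) (λ u w → R? (suc u) (suc w)) R-refl R-sym R-trans
... | c , f , kept , separated , covers with keep zero in k₀ | any? (λ i → R? zero (suc (f i)))
...   | false | _ = c , suc ∘ f , kept , separated , λ where
        zero k → ⊥-elim (not-¬ k k₀)
        (suc u) k → covers u k
...   | true | yes (i , r) = c , suc ∘ f , kept , separated , λ where
        zero _ → i , r
        (suc u) k → covers u k
...   | true | no unrelated = suc c , zero ◂ suc ∘ f , kept′ , separated′ , covers′
  where
  kept′ : ∀ i → keep ((zero ◂ suc ∘ f) i) ≡ true
  kept′ zero    = k₀
  kept′ (suc i) = kept i
  separated′ : ∀ i j → R ((zero ◂ suc ∘ f) i) ((zero ◂ suc ∘ f) j) → i ≡ j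
  separated′ zero    zero    _ = refl
  separated′ zero    (suc j) r = ⊥-elim (unrelated (j , r))
  separated′ (suc i) zero    r = ⊥-elim (unrelated (i , R-sym r))
  separated′ (suc i) (suc j) r = cong suc (separated i j r)
  covers′ : ∀ u → keep u ≡ true → ∃ λ i → R u ((zero ◂ suc ∘ f) i)
  covers′ zero    _ = zero , R-refl k₀
  covers′ (suc u) k = let i , r = covers u k in suc i , r

numComps-exists : ∀ {n} {E : Edges n} → SymmetricEdges E → ∀ keep → ∃ (NumComps keep E)
numComps-exists {E = E} E-sym keep =
  transversal-exists keep (Reach keep E) (reach? keep) here (reach-sym E-sym) reach-trans

numComps-≥ : ∀ {n} {keep : Fin n → Bool} {E : Edges n} → SymmetricEdges E → ∀ {c m} → NumComps keep E c →
             (xs : Fin m → Fin n) → (∀ i → keep (xs i) ≡ true) →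
             (∀ i j → Reach keep E (xs i) (xs j) → i ≡ j) → m ≤ c
numComps-≥ E-sym = transversal-≥ (reach-sym E-sym) reach-trans

connected⇒numComps≡1 : ∀ {n} (G : Graph n) → Connected G → Fin n → NumComps allV (adj G) 1
connected⇒numComps≡1 G connected v = (λ _ → v) , (λ _ → refl) , (λ { zero zero _ → refl }) ,
                                      λ u _ → zero , connected u v

-- Optimal path-cycle covers

allFunctions : ∀ {A : Set} → List A → (m : ℕ) → List (Fin m → A)
allFunctions as zero    = (λ ()) ∷ []
allFunctions as (suc m) = cartesianProductWith _◂_ as (allFunctions as m)

allFunctions-complete : ∀ {A : Set} (_≈_ : A → A → Set) {as : List A} →
                        (∀ a → ∃ λ b → b ∈ as × a ≈ b) →
                        ∀ m (g : Fin m → A) → ∃ λ f → f ∈ allFunctions as m × (∀ i → g i ≈ f i)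
allFunctions-complete _≈_ complete zero    g = (λ ()) , here refl , λ ()
allFunctions-complete _≈_ complete (suc m) g =
  let b , b∈ , gb = complete (g zero)
      f , f∈ , gf = allFunctions-complete _≈_ complete m (g ∘ suc)
  in b ◂ f , ∈-cartesianProductWith⁺ _◂_ b∈ f∈ , λ { zero → gb ; (suc i) → gf i }

allEdges : (n : ℕ) → List (Edges n)
allEdges n = allFunctions (allFunctions (true ∷ false ∷ []) n) n

allEdges-complete : ∀ {n} (H : Edges n) → ∃ λ H' → H' ∈ allEdges n × (∀ u v → H u v ≡ H' u v)
allEdges-complete {n} = allFunctions-complete (λ f g → ∀ v → f v ≡ g v)
  (allFunctions-complete _≡_ (λ { true → true , here refl , refl ; false → false , there (here refl) , refl }) n) n

module _ {n} (G : Graph n) where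

  isPCC? : ∀ H → Dec (IsPCC G H)
  isPCC? H = all? (λ u → all? λ v → H u v ≟ᴮ H v u)
       ×-dec all? (λ u → all? λ v → (H u v ≟ᴮ true) →-dec (adj G u v ≟ᴮ true))
       ×-dec all? (λ u → deg H u ≤? 2)

  isPCC-cong : ∀ {H H'} → (∀ u v → H u v ≡ H' u v) → IsPCC G H → IsPCC G H'
  isPCC-cong H≈H' (H-sym , H⊆G , H-deg) =
    (λ u v → trans (sym (H≈H' u v)) (trans (H-sym u v) (H≈H' v u))) ,
    (λ u v e → H⊆G u v (trans (H≈H' u v) e)) ,
    (λ u → subst (_≤ 2) (countTrue-cong (H≈H' u)) (H-deg u))

  empty-isPCC : IsPCC G (λ _ _ → false)
  empty-isPCC = (λ _ _ → refl) , (λ _ _ ()) ,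
                λ u → ≤-trans (≤-reflexive (countTrue-false {n} λ _ → refl)) z≤n

saturated : ∀ {n} → Edges n → ℕ
saturated H = countTrue (λ u → 2 ≤ᵇ deg H u)

-- Lexicographic in (edges, vertices of degree 2), as saturated H ≤ n.
score : ∀ {n} → Edges n → ℕ
score {n} H = numEdges H * suc n + saturated H

score-cong : ∀ {n} {H H' : Edges n} → (∀ u v → H u v ≡ H' u v) → score H ≡ score H'
score-cong H≈H' = cong₂ (λ e s → e * suc _ + s) (numEdges-cong H≈H')
  (countTrue-cong λ u → cong (2 ≤ᵇ_) (countTrue-cong (H≈H' u)))

Optimal : ∀ {n} → Graph n → Edges n → Set
Optimal G H = IsPCC G H × (∀ H' → IsPCC G H' → score H' ≤ score H)

optimal-exists : ∀ {n} (G : Graph n) → ∃ (Optimal G)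
optimal-exists {n} G = H , argmax-all score (empty-isPCC G) (all-filter (isPCC? G) (allEdges n)) , H-optimal
  where
  covers = filter (isPCC? G) (allEdges n)
  H = argmax score (λ _ _ → false) covers
  H-optimal : ∀ H' → IsPCC G H' → score H' ≤ score H
  H-optimal H' H'-pcc =
    let H'' , H''∈ , H'≈H'' = allEdges-complete H'
    in subst (_≤ score H) (sym (score-cong H'≈H''))
         (lookup (f[xs]≤f[argmax] {f = score} (λ _ _ → false) covers)
                 (∈-filter⁺ (isPCC? G) H''∈ (isPCC-cong G H'≈H'' H'-pcc)))

module _ {n} {G : Graph n} {H : Edges n} (H-optimal : Optimal G H) where

  optimal⇒maximum : IsMaxPCC G H
  optimal⇒maximum = proj₁ H-optimal ,
                    λ H' H'-pcc → ≮⇒≥ λ more → <⇒≱ (score-< more) (proj₂ H-optimal H' H'-pcc)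
    where
    score-< : ∀ {H' : Edges n} → numEdges H < numEdges H' → score H < score H'
    score-< {H'} more = begin-strict
      numEdges H * suc n + saturated H ≤⟨ +-monoʳ-≤ (numEdges H * suc n) (countTrue≤size _) ⟩
      numEdges H * suc n + n           <⟨ +-monoʳ-< (numEdges H * suc n) (n<1+n n) ⟩
      numEdges H * suc n + suc n       ≡⟨ +-comm (numEdges H * suc n) (suc n) ⟩
      suc (numEdges H) * suc n         ≤⟨ *-monoˡ-≤ (suc n) more ⟩
      numEdges H' * suc n              ≤⟨ m≤m+n (numEdges H' * suc n) (saturated H') ⟩
      numEdges H' * suc n + saturated H' ∎
      where open ≤-Reasoning

  optimal-saturated : ∀ {H'} → IsPCC G H' → numEdges H ≤ numEdges H' → saturated H' ≤ saturated H
  optimal-saturated {H'} H'-pcc fewer = ≮⇒≥ λ more →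
    <⇒≱ (+-mono-≤-< (*-monoˡ-≤ (suc n) fewer) more) (proj₂ H-optimal H' H'-pcc)

module _ {n} (G : Graph n) where

  adj-irrefl : ∀ {u v} → adj G u v ≡ true → ¬ u ≡ v
  adj-irrefl {u} Guv refl = not-¬ Guv (Graph.irrefl G u)

  adj-sym : ∀ {u v} → adj G u v ≡ true → adj G v u ≡ true
  adj-sym {u} {v} Guv = trans (Graph.sym G v u) Guv

module _ {n} {G : Graph n} where

  isPCC-irrefl : ∀ {H u v} → IsPCC G H → H u v ≡ true → ¬ u ≡ v
  isPCC-irrefl (_ , H⊆G , _) Huv = adj-irrefl G (H⊆G _ _ Huv)

  insertEdge-⊆ : ∀ {H x y} → H ⊆ᴱ adj G → adj G x y ≡ true → insertEdge H x y ⊆ᴱ adj G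
  insertEdge-⊆ {H} H⊆G Gxy u v e with ∨-elim (H u v) e
  ... | inj₁ Huv = H⊆G u v Huv
  ... | inj₂ xy with edge⁻ u v xy
  ...   | inj₁ (refl , refl) = Gxy
  ...   | inj₂ (refl , refl) = adj-sym G Gxy

  insertEdge-isPCC : ∀ {H x y} → IsPCC G H → adj G x y ≡ true → deg H x ≤ 1 → deg H y ≤ 1 →
                     IsPCC G (insertEdge H x y)
  insertEdge-isPCC {H} {x} {y} (H-sym , H⊆G , H-deg) Gxy x-free y-free =
    insertEdge-sym H-sym , insertEdge-⊆ H⊆G Gxy , λ u → ≤-trans (deg-insertEdge H x y u) (bound u)
    where
    bound : ∀ u → deg H u + countTrue (edge x y u) ≤ 2
    bound u with u ≟ x | u ≟ y
    ... | yes refl | _        = +-mono-≤ x-free (edge-row≤1 {x = x} {y} u)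
    ... | no _     | yes refl = +-mono-≤ y-free (edge-row≤1 {x = x} {y} u)
    ... | no u≢x   | no u≢y   = subst (λ k → deg H u + k ≤ 2) (sym (edge-row-off {x = x} {y} u≢x u≢y))
                                  (subst (_≤ 2) (sym (+-identityʳ _)) (H-deg u))

  maximum-no-free-edge : ∀ {H x y} → IsMaxPCC G H → adj G x y ≡ true → H x y ≡ false →
                         deg H x ≤ 1 → deg H y ≤ 1 → ⊥
  maximum-no-free-edge {H} {x} {y} (H-pcc , H-max) Gxy Hxy x-free y-free =
    <⇒≱ (numEdges-< (proj₁ H-pcc) (insertEdge-sym (proj₁ H-pcc)) (λ u v → ∨-introˡ _)
                    (adj-irrefl G Gxy) Hxy (∨-introʳ (H x y) (edge-xy {x = x} {y})))
        (H-max _ (insertEdge-isPCC H-pcc Gxy x-free y-free))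

private
  full⁺ : ∀ {k} → 2 ≤ k → (2 ≤ᵇ k) ≡ true
  full⁺ 2≤k = Equivalence.to T-≡ (≤⇒≤ᵇ 2≤k)

  full⁻ : ∀ {k} → (2 ≤ᵇ k) ≡ true → 2 ≤ k
  full⁻ e = ≤ᵇ⇒≤ 2 _ (Equivalence.from T-≡ e)

  not-full : ∀ {k} → k ≤ 1 → (2 ≤ᵇ k) ≡ false
  not-full k≤1 = ¬-not λ e → <⇒≱ (full⁻ e) k≤1

-- Replacing the edge cd of a path a–b–c–d by the chord ac closes the cycle a–b–c
-- without losing an edge, and turns the endpoint a into a vertex of degree 2.
module ClosingRotation {n} {G : Graph n} {H : Edges n} (H-pcc : IsPCC G H) {a b c d : Fin n}
         (a≢d : ¬ a ≡ d) (b≢d : ¬ b ≡ d) (c≢d : ¬ c ≡ d) (Gac : adj G a c ≡ true)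
         (Hab : H a b ≡ true) (a-nbr : ∀ v → H a v ≡ true → v ≡ b)
         (Hcb : H c b ≡ true) (c-nbr : ∀ v → H c v ≡ true → v ≡ b ⊎ v ≡ d)
         (d-nbr : ∀ v → H d v ≡ true → v ≡ c) where

  private
    H-sym = proj₁ H-pcc
    a≢b = isPCC-irrefl {G = G} H-pcc Hab
    c≢b = isPCC-irrefl {G = G} H-pcc Hcb
    a≢c = adj-irrefl G Gac
    H⁺ = insertEdge H a c

  rotated : Edges n
  rotated = removeEdge H⁺ c d

  private
    rotated⁻ : ∀ u v → rotated u v ≡ true → (H u v ≡ true ⊎ edge a c u v ≡ true) × ¬ edge c d u v ≡ true
    rotated⁻ u v e = ∨-elim (H u v) (∧-conicalˡ (H⁺ u v) (not (edge c d u v)) e)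
                   , λ cd → not-¬ (∧-conicalʳ (H⁺ u v) (not (edge c d u v)) e) (cong not cd)

    rotated⁺ : ∀ {u v} → H⁺ u v ≡ true → ¬ (u ≡ c × v ≡ d) → ¬ (u ≡ d × v ≡ c) →
               rotated u v ≡ true
    rotated⁺ = removeEdge-intro {H = H⁺}

    a-nbr′ : ∀ v → rotated a v ≡ true → v ≡ b ⊎ v ≡ c
    a-nbr′ v e with proj₁ (rotated⁻ a v e)
    ... | inj₁ Hav = inj₁ (a-nbr v Hav)
    ... | inj₂ ac with edge⁻ a v ac
    ...   | inj₁ (_ , v≡c) = inj₂ v≡c
    ...   | inj₂ (a≡c , _) = ⊥-elim (a≢c a≡c)

    c-nbr′ : ∀ v → rotated c v ≡ true → v ≡ b ⊎ v ≡ a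
    c-nbr′ v e with rotated⁻ c v e
    ... | inj₁ Hcv , not-cd with c-nbr v Hcv
    ...   | inj₁ v≡b  = inj₁ v≡b
    ...   | inj₂ refl = ⊥-elim (not-cd (edge-xy {x = c} {v}))
    c-nbr′ v e | inj₂ ac , _ with edge⁻ c v ac
    ...   | inj₁ (c≡a , _) = ⊥-elim (a≢c (sym c≡a))
    ...   | inj₂ (_ , v≡a) = inj₂ v≡a

    other-nbr : ∀ {u} → ¬ u ≡ a → ¬ u ≡ c → ∀ v → rotated u v ≡ true → H u v ≡ true
    other-nbr u≢a u≢c v e with proj₁ (rotated⁻ _ v e)
    ... | inj₁ Huv = Huv
    ... | inj₂ ac with edge⁻ _ v ac
    ...   | inj₁ (u≡a , _) = ⊥-elim (u≢a u≡a)
    ...   | inj₂ (u≡c , _) = ⊥-elim (u≢c u≡c)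

  rotated-isPCC : IsPCC G rotated
  rotated-isPCC = removeEdge-sym (insertEdge-sym H-sym)
                , (λ u v e → insertEdge-⊆ {G = G} (proj₁ (proj₂ H-pcc)) Gac u v (∧-conicalˡ (H⁺ u v) _ e))
                , rotated-deg
    where
    rotated-deg : ∀ u → deg rotated u ≤ 2
    rotated-deg u with u ≟ a | u ≟ c
    ... | yes refl | _        = countTrue≤2 b c a-nbr′
    ... | no _     | yes refl = countTrue≤2 b a c-nbr′
    ... | no u≢a   | no u≢c   = ≤-trans (countTrue-mono (other-nbr u≢a u≢c)) (proj₂ (proj₂ H-pcc) u)

  numEdges-rotated : numEdges H ≤ numEdges rotated
  numEdges-rotated = ≤-pred (≤-trans
    (numEdges-< H-sym (insertEdge-sym H-sym) (λ u v → ∨-introˡ _) a≢c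
      (¬-not λ Hac → c≢b (a-nbr c Hac)) (∨-introʳ (H a c) (edge-xy {x = a} {c})))
    (numEdges-removeEdge H⁺ c≢d))

  saturated-rotated : saturated H < saturated rotated
  saturated-rotated =
    countTrue-< stays-full a (not-full (countTrue≤1 b a-nbr)) (full⁺ (countTrue≥2 (c≢b ∘ sym) ab ac))
    where
    ab = rotated⁺ (∨-introˡ _ Hab) (a≢c ∘ proj₁) (a≢d ∘ proj₁)
    ac = rotated⁺ (∨-introʳ (H a c) (edge-xy {x = a} {c})) (a≢c ∘ proj₁) (a≢d ∘ proj₁)
    cb = rotated⁺ (∨-introˡ _ Hcb) (b≢d ∘ proj₂) (c≢d ∘ proj₁)
    ca = rotated⁺ (∨-introʳ (H c a) (edge-yx {x = a} {c})) (a≢d ∘ proj₂) (c≢d ∘ proj₁)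
    stays-full : ∀ u → (2 ≤ᵇ deg H u) ≡ true → (2 ≤ᵇ deg rotated u) ≡ true
    stays-full u full with u ≟ c | u ≟ d
    ... | yes refl | _        = full⁺ (countTrue≥2 (a≢b ∘ sym) cb ca)
    ... | no _     | yes refl = ⊥-elim (not-¬ full (not-full (countTrue≤1 c d-nbr)))
    ... | no u≢c   | no u≢d   = full⁺ (≤-trans (full⁻ full) (countTrue-mono {f = H u} {g = rotated u} λ v Huv →
                                  rotated⁺ (∨-introˡ _ Huv) (u≢c ∘ proj₁) (u≢d ∘ proj₁)))

optimal-no-closing-rotation :
  ∀ {n} {G : Graph n} {H} → Optimal G H → ∀ {a b c d} → ¬ a ≡ d → ¬ b ≡ d → ¬ c ≡ d →
  adj G a c ≡ true → H a b ≡ true → (∀ v → H a v ≡ true → v ≡ b) →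
  H c b ≡ true → (∀ v → H c v ≡ true → v ≡ b ⊎ v ≡ d) → (∀ v → H d v ≡ true → v ≡ c) → ⊥
optimal-no-closing-rotation {G = G} H-opt a≢d b≢d c≢d Gac Hab a-nbr Hcb c-nbr d-nbr =
  <⇒≱ saturated-rotated (optimal-saturated {G = G} H-opt rotated-isPCC numEdges-rotated)
  where open ClosingRotation {G = G} (proj₁ H-opt) a≢d b≢d c≢d Gac Hab a-nbr Hcb c-nbr d-nbr

-- Path components

opposite-suc : ∀ {m} {i j : Fin m} → suc (toℕ i) ≡ toℕ j → suc (toℕ (opposite j)) ≡ toℕ (opposite i)
opposite-suc {m} {i} {j} i+1≡j = begin
  suc (toℕ (opposite j))      ≡⟨ cong suc (opposite-prop j) ⟩
  suc (m ∸ suc (toℕ j))       ≡⟨ cong (λ k → suc (m ∸ suc k)) (sym i+1≡j) ⟩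
  suc (m ∸ suc (suc (toℕ i))) ≡⟨ sym (+-∸-assoc 1 (subst (λ k → suc k ≤ m) (sym i+1≡j) (toℕ<n j))) ⟩
  m ∸ suc (toℕ i)             ≡⟨ sym (opposite-prop i) ⟩
  toℕ (opposite i)            ∎
  where open ≡-Reasoning

opposite-suc⁻ : ∀ {m} {i j : Fin m} → suc (toℕ (opposite i)) ≡ toℕ (opposite j) → suc (toℕ j) ≡ toℕ i
opposite-suc⁻ {i = i} {j} =
  subst₂ (λ x y → suc (toℕ x) ≡ toℕ y) (opposite-involutive j) (opposite-involutive i) ∘ opposite-suc

module PathComponents {n} (H : Edges n) where

  pathComponent-nbr : ∀ {k p} → IsPathComponent H k p → ∀ i w → H (p i) w ≡ true →
                      ∃ λ j → w ≡ p j × (suc (toℕ i) ≡ toℕ j ⊎ suc (toℕ j) ≡ toℕ i)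
  pathComponent-nbr (_ , only-consecutive , _ , closed) i w e with closed i w e
  ... | j , refl = j , refl , only-consecutive i j e

  first-nbr : ∀ {k p} → IsPathComponent H (suc k) p → ∀ w → H (p zero) w ≡ true → w ≡ p (suc zero)
  first-nbr pc w e with pathComponent-nbr pc zero w e
  ... | suc zero    , w≡ , _ = w≡
  ... | zero        , _  , inj₁ ()
  ... | zero        , _  , inj₂ ()
  ... | suc (suc _) , _  , inj₁ ()
  ... | suc (suc _) , _  , inj₂ ()

  second-nbr : ∀ {k p} → IsPathComponent H (suc (suc k)) p → ∀ w → H (p (suc zero)) w ≡ true →
               w ≡ p zero ⊎ w ≡ p (suc (suc zero))
  second-nbr pc w e with pathComponent-nbr pc (suc zero) w e
  ... | zero              , w≡ , _ = inj₁ w≡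
  ... | suc (suc zero)    , w≡ , _ = inj₂ w≡
  ... | suc zero          , _  , inj₁ ()
  ... | suc zero          , _  , inj₂ ()
  ... | suc (suc (suc _)) , _  , inj₁ ()
  ... | suc (suc (suc _)) , _  , inj₂ ()

  reverse-pathComponent : SymmetricEdges H → ∀ {k p} → IsPathComponent H k p → IsPathComponent H k (p ∘ opposite)
  reverse-pathComponent H-sym {p = p} (injective , only-consecutive , consecutive , closed) =
    (λ i j e → subst₂ _≡_ (opposite-involutive i) (opposite-involutive j) (cong opposite (injective _ _ e))) ,
    (λ i j e → swap (Sum.map opposite-suc⁻ opposite-suc⁻ (only-consecutive _ _ e))) ,
    (λ i j i+1≡j → trans (H-sym _ _) (consecutive _ _ (opposite-suc i+1≡j))) ,
    λ i w e → let j , pj≡w = closed _ w e in opposite j , trans (cong p (opposite-involutive j)) pj≡w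

  reach-along-path : ∀ {k p} → IsPathComponent H k p → ∀ m (i : Fin (suc k)) → toℕ i ≡ m →
                     Reach allV H (p zero) (p i)
  reach-along-path pc _       zero    _ = here refl
  reach-along-path pc (suc m) (suc i) i+1≡m+1 =
    step (reach-along-path pc m (inject₁ i) (trans (toℕ-inject₁ i) (suc-injective i+1≡m+1)))
         (proj₁ (proj₂ (proj₂ pc)) (inject₁ i) (suc i) (cong suc (toℕ-inject₁ i))) refl

  spanning-pathComponent⇒numComps≡1 : SymmetricEdges H → ∀ {k p} → IsPathComponent H k p →
                                      (∀ u → ∃ λ j → p j ≡ u) → NumComps allV H 1
  spanning-pathComponent⇒numComps≡1 H-sym {p = p} pc spanning =
    (λ _ → p zero) , (λ _ → refl) , (λ { zero zero _ → refl }) , λ u _ → zero , to-first u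
    where
    to-first : ∀ u → Reach allV H u (p zero)
    to-first u with spanning u
    ... | j , refl = reach-sym H-sym (reach-along-path pc (toℕ j) j refl)

module _ {n} (G : Graph n) {k} (p : Fin (suc k) → Fin n) where

  hasOutsideNbr? : ∀ e → Dec (HasOutsideNbr G p e)
  hasOutsideNbr? e with any? (λ w → (adj G e w ≟ᴮ true) ×-dec all? (λ j → ¬? (p j ≟ w)))
  ... | yes (w , Gew , outside) = yes (w , Gew , outside)
  ... | no none                 = no λ (w , Gew , outside) → none (w , Gew , outside)

  inside-nbr : ∀ {e} → ¬ HasOutsideNbr G p e → ∀ w → adj G e w ≡ true → ∃ λ j → p j ≡ w
  inside-nbr no-out w Gew with any? (λ j → p j ≟ w)
  ... | yes inside = inside
  ... | no outside = ⊥-elim (no-out (w , Gew , λ j pj≡w → outside (j , pj≡w)))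

  closed⇒spanning : Connected G → (∀ j → ¬ HasOutsideNbr G p (p j)) → ∀ u → ∃ λ j → p j ≡ u
  closed⇒spanning connected closed u = walk (connected (p zero) u)
    where
    walk : ∀ {v} → Reach allV (adj G) (p zero) v → ∃ λ j → p j ≡ v
    walk (here _) = zero , refl
    walk (step r Gvw _) with walk r
    ... | j , refl = inside-nbr (closed j) _ Gvw

  hasOutsideNbr-reverse : ∀ {e} → HasOutsideNbr G p e → HasOutsideNbr G (p ∘ opposite) e
  hasOutsideNbr-reverse (w , Gew , outside) = w , Gew , outside ∘ opposite

  hasOutsideNbr-unreverse : ∀ {e} → HasOutsideNbr G (p ∘ opposite) e → HasOutsideNbr G p e
  hasOutsideNbr-unreverse (w , Gew , outside) =
    w , Gew , λ j pj≡w → outside (opposite j) (trans (cong p (opposite-involutive j)) pj≡w)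

-- Leaves, cut edges and cut vertices

module _ {n} (G : Graph n) where

  pendant-isolated : ∀ {a b} → (∀ w → adj G a w ≡ true → w ≡ b) →
                     ∀ {w} → Reach (delVert b) (adj G) a w → w ≡ a
  pendant-isolated only-b (here _) = refl
  pendant-isolated {b = b} only-b (step {w = w} r Gvw kw) with pendant-isolated only-b r
  ... | refl = ⊥-elim (not-¬ kw (subst (λ x → not (x == b) ≡ false) (sym (only-b w Gvw)) (cong not (==-refl b))))

  pendant⇒isLeaf : ∀ {a b} → adj G a b ≡ true → (∀ w → adj G a w ≡ true → w ≡ b) → IsLeaf G a
  pendant⇒isLeaf Gab only-b = countTrue≡1 _ Gab only-b

  detour⇒¬cutEdge : ∀ {b c} → Reach allV (delEdge G b c) b c → ¬ IsCutEdge G b c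
  detour⇒¬cutEdge {b} {c} detour (c₁ , c₂ , G-comps , (f , _ , separated , _) , fewer) =
    <⇒≱ fewer (numComps-≥ (Graph.sym G) G-comps f (λ _ → refl) λ i j r → separated i j (lift r))
    where
    D-sym : SymmetricEdges (delEdge G b c)
    D-sym = removeEdge-sym (Graph.sym G)
    lift : ∀ {u w} → Reach allV (adj G) u w → Reach allV (delEdge G b c) u w
    lift (here _) = here refl
    lift (step {v = v} {w} r Gvw _) with edge b c v w in bc
    ... | false = step (lift r) (∧-intro Gvw (cong not bc)) refl
    ... | true with edge⁻ v w bc
    ...   | inj₁ (refl , refl) = reach-trans (lift r) detour
    ...   | inj₂ (refl , refl) = reach-trans (lift r) (reach-sym D-sym detour)

  private
    kept⇒≢ : ∀ {b u : Fin n} → delVert b u ≡ true → ¬ u ≡ b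
    kept⇒≢ {b} {u} k refl = not-¬ k (cong not (==-refl b))

  bypass⇒¬cutEdge : ∀ {b c x} → adj G b x ≡ true → ¬ x ≡ c → Reach (delVert b) (adj G) x c →
                    ¬ IsCutEdge G b c
  bypass⇒¬cutEdge {b} {c} Gbx x≢c x⇝c = detour⇒¬cutEdge
    (reach-prepend refl
      (removeEdge-intro {H = adj G} {b} {c} Gbx (x≢c ∘ proj₂) (adj-irrefl G Gbx ∘ sym ∘ proj₂))
      (reach-map (λ _ _ → refl) avoid-b x⇝c))
    where
    avoid-b : ∀ u v → delVert b u ≡ true → delVert b v ≡ true → adj G u v ≡ true →
              delEdge G b c u v ≡ true
    avoid-b u v ku kv Guv =
      removeEdge-intro {H = adj G} {b} {c} Guv (kept⇒≢ {b} ku ∘ proj₁) (kept⇒≢ {b} kv ∘ proj₂)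

  -- By (R2) the neighbour b of a leaf a does not split G into three components;
  -- since a is isolated in G − b, the rest of G − b is connected.
  pendant-hub-¬¬reach : Connected G → Reduced G →
                        ∀ {a b} → adj G a b ≡ true → (∀ w → adj G a w ≡ true → w ≡ b) →
                        ∀ {y z} → ¬ y ≡ b → ¬ z ≡ b → ¬ y ≡ a → ¬ z ≡ a →
                        ¬ ¬ Reach (delVert b) (adj G) y z
  pendant-hub-¬¬reach connected (_ , no-super) {a} {b} Gab only-b {y} {z} y≢b z≢b y≢a z≢a y↮z
    with numComps-exists (Graph.sym G) (delVert b)
  ... | c , comps = no-super b (1 , c , one , comps , ≤-trans (n≤1+n 2) three≤c)
                      (a , pendant⇒isLeaf Gab only-b , adj-sym G Gab) (1 , c , one , comps , three≤c)
    where
    one = connected⇒numComps≡1 G connected b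
    xs : Fin 3 → Fin n
    xs zero             = a
    xs (suc zero)       = y
    xs (suc (suc zero)) = z
    isolated : ∀ {w} → Reach (delVert b) (adj G) a w → w ≡ a
    isolated = pendant-isolated only-b
    G-sym = Graph.sym G
    separated : ∀ i j → Reach (delVert b) (adj G) (xs i) (xs j) → i ≡ j
    separated zero             zero             _ = refl
    separated zero             (suc zero)       r = ⊥-elim (y≢a (isolated r))
    separated zero             (suc (suc zero)) r = ⊥-elim (z≢a (isolated r))
    separated (suc zero)       zero             r = ⊥-elim (y≢a (isolated (reach-sym G-sym r)))
    separated (suc zero)       (suc zero)       _ = refl
    separated (suc zero)       (suc (suc zero)) r = ⊥-elim (y↮z r)
    separated (suc (suc zero)) zero             r = ⊥-elim (z≢a (isolated (reach-sym G-sym r)))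
    separated (suc (suc zero)) (suc zero)       r = ⊥-elim (y↮z (reach-sym G-sym r))
    separated (suc (suc zero)) (suc (suc zero)) _ = refl
    kept : ∀ i → delVert b (xs i) ≡ true
    kept zero             = cong not (≢⇒==-false (adj-irrefl G Gab))
    kept (suc zero)       = cong not (≢⇒==-false y≢b)
    kept (suc (suc zero)) = cong not (≢⇒==-false z≢b)
    three≤c : 3 ≤ c
    three≤c = numComps-≥ {keep = delVert b} {E = adj G} G-sym comps xs kept separated

module ShortPaths {n} (G : Graph n) (connected : Connected G) (reduced : Reduced G)
                  (not-single : ∀ H → IsMaxPCC G H → ¬ NumComps allV H 1)
                  {H : Edges n} (H-optimal : Optimal G H) where

  open PathComponents H

  private
    H-pcc = proj₁ H-optimal
    H-sym = proj₁ H-pcc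
    H⊆G   = proj₁ (proj₂ H-pcc)
    H-maximum = optimal⇒maximum {G = G} H-optimal
    Out : ∀ {k} → (Fin (suc k) → Fin n) → Fin n → Set
    Out = HasOutsideNbr G
    edge-at : ∀ {k p} → IsPathComponent H k p → ∀ i j → _ → H (p i) (p j) ≡ true
    edge-at pc = proj₁ (proj₂ (proj₂ pc))

    distinct : ∀ {k p} → IsPathComponent H k p → ∀ i j → ¬ i ≡ j → ¬ p i ≡ p j
    distinct pc i j i≢j = i≢j ∘ proj₁ pc i j

  no-closed-pathComponent : ∀ {k p} → IsPathComponent H k p → (∀ j → ¬ Out p (p j)) → ⊥
  no-closed-pathComponent {p = p} pc closed = not-single H H-maximum
    (spanning-pathComponent⇒numComps≡1 H-sym pc (closed⇒spanning G p connected closed))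

  no-chord-to-last : ∀ {k p} → IsPathComponent H (suc (suc k)) p →
                     adj G (p zero) (p (fromℕ (suc (suc k)))) ≡ true → ⊥
  no-chord-to-last {p = p} pc G-chord = maximum-no-free-edge {G = G} H-maximum G-chord
    (¬-not λ H-chord → case proj₁ pc _ _ (first-nbr pc _ H-chord) of λ ())
    (countTrue≤1 _ (first-nbr pc)) (countTrue≤1 _ (first-nbr (reverse-pathComponent H-sym pc)))

  endpoint-pendant : ∀ {k} → k ≤ 1 → ∀ {p} → IsPathComponent H (suc (suc k)) p → ¬ Out p (p zero) →
                     ∀ w → adj G (p zero) w ≡ true → w ≡ p (suc zero)
  endpoint-pendant {zero} _ {p} pc closed w Gaw with inside-nbr G p closed w Gaw
  ... | zero           , refl = ⊥-elim (adj-irrefl G Gaw refl)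
  ... | suc zero       , refl = refl
  ... | suc (suc zero) , refl = ⊥-elim (no-chord-to-last pc Gaw)
  endpoint-pendant {suc zero} _ {p} pc closed w Gaw with inside-nbr G p closed w Gaw
  ... | zero                 , refl = ⊥-elim (adj-irrefl G Gaw refl)
  ... | suc zero             , refl = refl
  ... | suc (suc zero)       , refl = ⊥-elim (optimal-no-closing-rotation {G = G} H-optimal
          (distinct pc (# 0) (# 3) λ ()) (distinct pc (# 1) (# 3) λ ()) (distinct pc (# 2) (# 3) λ ())
          Gaw (edge-at pc (# 0) (# 1) refl) (first-nbr pc)
          (trans (H-sym _ _) (edge-at pc (# 1) (# 2) refl)) (λ v → swap ∘ second-nbr reversed v) (first-nbr reversed))
    where reversed = reverse-pathComponent H-sym pc
  ... | suc (suc (suc zero)) , refl = ⊥-elim (no-chord-to-last pc Gaw)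
  endpoint-pendant {suc (suc _)} (s≤s ())

  ¬exit-at-second₂ : ∀ {p} → IsPathComponent H 2 p →
                     ¬ Out p (p (# 0)) → ¬ Out p (p (# 2)) → ¬ Out p (p (# 1))
  ¬exit-at-second₂ {p} pc closed₀ closed₂ (x , Gbx , x-outside) =
    pendant-hub-¬¬reach G connected reduced
      (H⊆G _ _ (edge-at pc (# 0) (# 1) refl)) (endpoint-pendant z≤n pc closed₀)
      (distinct pc (# 2) (# 1) λ ()) (x-outside (# 1) ∘ sym) (distinct pc (# 2) (# 0) λ ()) (x-outside (# 0) ∘ sym)
      λ c⇝x → x-outside (# 2) (sym (pendant-isolated G c-pendant c⇝x))
    where
    c-pendant = endpoint-pendant z≤n (reverse-pathComponent H-sym pc) (closed₂ ∘ hasOutsideNbr-unreverse G p)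

  ¬exit-at-second₃ : ∀ {p} → IsPathComponent H 3 p →
                     ¬ Out p (p (# 0)) → ¬ Out p (p (# 3)) → ¬ Out p (p (# 1))
  ¬exit-at-second₃ {p} pc closed₀ closed₃ (x , Gbx , x-outside) =
    pendant-hub-¬¬reach G connected reduced Gab a-pendant
      (distinct pc (# 2) (# 1) λ ()) (x-outside (# 1) ∘ sym) (distinct pc (# 2) (# 0) λ ()) (x-outside (# 0) ∘ sym)
      λ c⇝x → bypass⇒¬cutEdge G Gbx (x-outside (# 2) ∘ sym) (reach-sym (Graph.sym G) c⇝x) bc-cut
    where
    Gab = H⊆G _ _ (edge-at pc (# 0) (# 1) refl)
    Gdc = H⊆G _ _ (trans (H-sym _ _) (edge-at pc (# 2) (# 3) refl))
    a-pendant = endpoint-pendant (s≤s z≤n) pc closed₀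
    d-pendant = endpoint-pendant (s≤s z≤n) (reverse-pathComponent H-sym pc) (closed₃ ∘ hasOutsideNbr-unreverse G p)
    bc-cut = proj₁ reduced _ _ (H⊆G _ _ (edge-at pc (# 1) (# 2) refl))
               (p (# 0) , pendant⇒isLeaf G Gab a-pendant , adj-sym G Gab)
               (p (# 3) , pendant⇒isLeaf G Gdc d-pendant , adj-sym G Gdc)

  short-pathComponent-exits : ∀ k → k ≤ 3 → ∀ p → IsPathComponent H k p →
                              ¬ Out p (p zero) → ¬ Out p (p (fromℕ k)) → ⊥
  short-pathComponent-exits 0 _ p pc closed₀ _ = no-closed-pathComponent pc λ { zero → closed₀ }
  short-pathComponent-exits 1 _ p pc closed₀ closed₁ =
    no-closed-pathComponent pc λ { zero → closed₀ ; (suc zero) → closed₁ }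
  short-pathComponent-exits 2 _ p pc closed₀ closed₂ =
    no-closed-pathComponent pc λ { zero → closed₀ ; (suc zero) → ¬exit-at-second₂ pc closed₀ closed₂
                                 ; (suc (suc zero)) → closed₂ }
  short-pathComponent-exits 3 _ p pc closed₀ closed₃ =
    no-closed-pathComponent pc λ { zero → closed₀ ; (suc zero) → ¬exit-at-second₃ pc closed₀ closed₃
                                 ; (suc (suc zero)) → third ; (suc (suc (suc zero))) → closed₃ }
    where
    third : ¬ Out p (p (# 2))
    third = ¬exit-at-second₃ (reverse-pathComponent H-sym pc) (closed₃ ∘ hasOutsideNbr-unreverse G p)
              (closed₀ ∘ hasOutsideNbr-unreverse G p) ∘ hasOutsideNbr-reverse G p
  short-pathComponent-exits (suc (suc (suc (suc _)))) (s≤s (s≤s (s≤s ())))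

lemma10 : ∀ {n} (G : Graph n) → Connected G → ¬ IsTree G → Reduced G →
    (∀ H → IsMaxPCC G H → ¬ NumComps allV H 1) →
    Σ (Fin n → Fin n → Bool) λ H → IsMaxPCC G H ×
      (∀ k → k ≤ 3 → (p : Fin (suc k) → Fin n) → IsPathComponent H k p →
        HasOutsideNbr G p (p zero) ⊎ HasOutsideNbr G p (p (fromℕ k)))
lemma10 G connected _ reduced not-single with optimal-exists G
... | H , H-optimal = H , optimal⇒maximum {G = G} H-optimal , exits
  where
  open ShortPaths G connected reduced not-single H-optimal
  exits : ∀ k → k ≤ 3 → ∀ p → IsPathComponent H k p →
          HasOutsideNbr G p (p zero) ⊎ HasOutsideNbr G p (p (fromℕ k))
  exits k k≤3 p pc with hasOutsideNbr? G p (p zero) | hasOutsideNbr? G p (p (fromℕ k))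
  ... | yes exit₀  | _          = inj₁ exit₀
  ... | no _       | yes exitₖ  = inj₂ exitₖ
  ... | no closed₀ | no closedₖ = ⊥-elim (short-pathComponent-exits k k≤3 p pc closed₀ closedₖ)
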